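{- For any permutation $\sigma\in\mathrm{Sym}(n)$, the cyclic group $G=\langle\sigma\rangle\le\mathrm{Sym}(n)$, with its natural action on $[n]=\{1,\dots,n\}$, has the strict EKR property.
   Context: Let $G\le \mathrm{Sym}(n)$ act naturally on $[n]$. Two permutations $\pi,\sigma\in G$ intersect if $\pi\sigma^{ -1}$ fixes some point of $[n]$; a subset of $G$ is intersecting if every pair of its elements intersect. $G$ has the EKR property if every intersecting subset of $G$ has size at most the size of the largest point-stabilizer $G_x$ ($x\in[n]$). $G$ has the strict EKR property if it has the EKR property and every intersecting subset of $G$ of maximum size is a coset of a point-stabilizer, i.e. a set of the form $\{\pi\in G:\pi(i)=j\}$ for some $i,j\in[n]$. -}

module Defs where

open import Data.Nat using (ℕ; zero; suc; _≤_)
open import Data.Fin using (Fin)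
open import Data.Fin.Permutation using (Permutation′; _⟨$⟩ʳ_; _≈_; id; flip; _∘ₚ_)
open import Data.List using (List; length)
open import Data.List.Relation.Unary.All using (All)
open import Data.List.Relation.Unary.Any using (Any)
open import Data.List.Relation.Unary.AllPairs using (AllPairs)
open import Data.Product using (Σ; ∃; _×_)
open import Relation.Binary.PropositionalEquality using (_≡_)
open import Relation.Nullary using (¬_)

_^ₚ_ : {n : ℕ} → Permutation′ n → ℕ → Permutation′ n
σ ^ₚ zero  = id
σ ^ₚ suc k = σ ∘ₚ (σ ^ₚ k)

InCyclic : {n : ℕ} → Permutation′ n → Permutation′ n → Set
InCyclic σ π = ∃ λ k → π ≈ (σ ^ₚ k)

IsSubsetOfCyclic : {n : ℕ} → Permutation′ n → List (Permutation′ n) → Set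
IsSubsetOfCyclic σ L = All (InCyclic σ) L × AllPairs (λ a b → ¬ (a ≈ b)) L

-- π and ρ intersect: π ρ⁻¹ fixes some point.
-- (flip ρ ∘ₚ π applies ρ⁻¹ first, then π, i.e. it is π ρ⁻¹.)
Intersect : {n : ℕ} → Permutation′ n → Permutation′ n → Set
Intersect {n} π ρ = ∃ λ (y : Fin n) → (flip ρ ∘ₚ π) ⟨$⟩ʳ y ≡ y

IsIntersecting : {n : ℕ} → List (Permutation′ n) → Set
IsIntersecting L = All (λ π → All (λ ρ → Intersect π ρ) L) L

IsSubsetOfStabilizer : {n : ℕ} → Permutation′ n → Fin n → List (Permutation′ n) → Set
IsSubsetOfStabilizer σ x S = IsSubsetOfCyclic σ S × All (λ π → π ⟨$⟩ʳ x ≡ x) S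

-- EKR property for ⟨σ⟩: every intersecting subset F has |F| ≤ |G_x| for some x
-- (equivalently ≤ the largest stabilizer size), witnessed by a subset of G_x of size ≥ |F|.
HasEKR : {n : ℕ} → Permutation′ n → Set
HasEKR {n} σ =
  (F : List (Permutation′ n)) → IsSubsetOfCyclic σ F → IsIntersecting F →
  ∃ λ (x : Fin n) → ∃ λ (S : List (Permutation′ n)) →
    IsSubsetOfStabilizer σ x S × length F ≤ length S

IsCoset : {n : ℕ} → Permutation′ n → List (Permutation′ n) → Set
IsCoset {n} σ F = ∃ λ (i : Fin n) → ∃ λ (j : Fin n) →
  All (λ π → π ⟨$⟩ʳ i ≡ j) F ×
  ((π : Permutation′ n) → InCyclic σ π → π ⟨$⟩ʳ i ≡ j → Any (λ ρ → π ≈ ρ) F)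

-- Strict EKR: EKR holds, and every intersecting subset of maximum size
-- (i.e. of size at least |G_x| for every x) is a coset of a point-stabilizer.
HasStrictEKR : {n : ℕ} → Permutation′ n → Set
HasStrictEKR {n} σ = HasEKR σ ×
  ((F : List (Permutation′ n)) → IsSubsetOfCyclic σ F → IsIntersecting F →
   ((x : Fin n) (S : List (Permutation′ n)) → IsSubsetOfStabilizer σ x S → length S ≤ length F) →
   IsCoset σ F)

-- Let ℓ be the length of a shortest cycle of σ and x₀ a point on it. Every g ∈ ⟨σ⟩ is moved into
-- the stabilizer H of x₀ by a power σ^k with k < ℓ read off from g x₀. If two intersecting elements
-- land on the same element of H they differ by σ^c with c < ℓ; but such a σ^c fixes a point only
-- when c = 0, as no cycle is shorter than ℓ. So this map is injective on an intersecting family F,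
-- and |F| ≤ |H|. If |F| is maximum the map is onto H, also for every translate F σ^t; hence each
-- g ∈ ⟨σ⟩ equals σ^(-c) f for some f ∈ F and c < ℓ. For g = σ f, meeting f forces c = ℓ - 1, so
-- σ^ℓ f ∈ F: F is a union of cosets of ⟨σ^ℓ⟩, and as its members pairwise intersect they all
-- agree at x₀. The same window property then puts every π with π x₀ = f x₀ into F.

module Submission where

open import Defs
open import Data.Nat using (ℕ; zero; suc; _+_; _*_; _∸_; _≤_; _<_; z≤n; s≤s; NonZero)
open import Data.Nat.Properties
open import Data.Nat.Induction using (<-wellFounded)
open import Data.Nat.DivMod using (_/_; _%_; m≡m%n+[m/n]*n; m%n<n)
open import Data.Fin using (Fin; toℕ; fromℕ<)
open import Data.Fin.Patterns using (0F)
open import Data.Fin.Properties using (any?; all?; pigeonhole; toℕ<n; toℕ-fromℕ<)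
  renaming (_≟_ to _≟ᶠ_)
open import Data.Fin.Permutation
  using (Permutation′; _⟨$⟩ʳ_; _⟨$⟩ˡ_; _≈_; id; _∘ₚ_; inverseˡ; inverseʳ)
open import Data.List using (List; []; _∷_; length; map)
open import Data.List.Properties using (length-map)
open import Data.List.Membership.Propositional using (_∈_; find)
open import Data.List.Relation.Unary.All as All using (All; []; _∷_)
open import Data.List.Relation.Unary.All.Properties using (¬Any⇒All¬) renaming (map⁺ to All-map⁺)
open import Data.List.Relation.Unary.Any as Any using (Any; here)
open import Data.List.Relation.Unary.AllPairs as AllPairs using (AllPairs; []; _∷_)
open import Data.List.Relation.Unary.AllPairs.Properties using () renaming (map⁺ to AllPairs-map⁺)
open import Data.Product using (∃; _×_; _,_; proj₁; proj₂)
open import Data.Sum using (inj₁; inj₂; [_,_]′)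
open import Induction.WellFounded using (Acc; acc)
open import Relation.Nullary using (¬_; Dec; yes; no; contradiction)
open import Relation.Unary using (Decidable)
open import Relation.Binary.PropositionalEquality

least-witness : {P : ℕ → Set} → Decidable P → ∀ {n} → P n →
                ∃ λ m → P m × (∀ {k} → k < m → ¬ P k)
least-witness {P} P? {n} = descend (<-wellFounded n)
  where
  descend : ∀ {n} → Acc _<_ n → P n → ∃ λ m → P m × (∀ {k} → k < m → ¬ P k)
  descend {n} (acc smaller) pn with anyUpTo? P? n
  ... | yes (k , k<n , pk) = descend (smaller k<n) pk
  ... | no none            = n , pn , λ k<n pk → none (_ , k<n , pk)

all-pairs : {A : Set} {R : A → A → Set} {xs : List A} →
            All (λ a → All (R a) xs) xs → AllPairs R xs
all-pairs {xs = []}     []               = []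
all-pairs {xs = x ∷ xs} ((_ ∷ rx) ∷ rxs) = rx ∷ all-pairs (All.map All.tail rxs)

module Powers {n : ℕ} (σ : Permutation′ n) where

  Perm : Set
  Perm = Permutation′ n

  pow : ℕ → Fin n → Fin n
  pow k x = (σ ^ₚ k) ⟨$⟩ʳ x

  -- Since ∘ₚ applies its left argument first, a ·σ^ k is σ^k ∘ a as a function.
  infixl 7 _·σ^_
  _·σ^_ : Perm → ℕ → Perm
  a ·σ^ k = a ∘ₚ (σ ^ₚ k)

  pow-+ : ∀ a b x → pow (a + b) x ≡ pow b (pow a x)
  pow-+ zero    b x = refl
  pow-+ (suc a) b x = pow-+ a b (σ ⟨$⟩ʳ x)

  pow-comm : ∀ a b x → pow a (pow b x) ≡ pow b (pow a x)
  pow-comm a b x = begin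
    pow a (pow b x) ≡⟨ pow-+ b a x ⟨
    pow (b + a) x   ≡⟨ cong (λ k → pow k x) (+-comm b a) ⟩
    pow (a + b) x   ≡⟨ pow-+ a b x ⟩
    pow b (pow a x) ∎
    where open ≡-Reasoning

  pow-injective : ∀ k {x y} → pow k x ≡ pow k y → x ≡ y
  pow-injective zero    eq = eq
  pow-injective (suc k) {x} {y} eq = begin
    x                      ≡⟨ inverseˡ σ ⟨
    σ ⟨$⟩ˡ (σ ⟨$⟩ʳ x)      ≡⟨ cong (σ ⟨$⟩ˡ_) (pow-injective k eq) ⟩
    σ ⟨$⟩ˡ (σ ⟨$⟩ʳ y)      ≡⟨ inverseˡ σ ⟩
    y                      ∎
    where open ≡-Reasoning

  pow-returns : ∀ x → ∃ λ k → pow (suc k) x ≡ x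
  pow-returns x with pigeonhole (n<1+n n) (λ (i : Fin (suc n)) → pow (toℕ i) x)
  ... | i , j , i<j , pᵢ≡pⱼ = d , pow-injective (toℕ i) (begin
      pow (toℕ i) (pow (suc d) x) ≡⟨ pow-comm (toℕ i) (suc d) x ⟩
      pow (suc d) (pow (toℕ i) x) ≡⟨ pow-+ (toℕ i) (suc d) x ⟨
      pow (toℕ i + suc d) x       ≡⟨ cong (λ k → pow k x) i+suc-d≡j ⟩
      pow (toℕ j) x               ≡⟨ pᵢ≡pⱼ ⟨
      pow (toℕ i) x               ∎)
    where
    open ≡-Reasoning
    d = toℕ j ∸ suc (toℕ i)
    i+suc-d≡j : toℕ i + suc d ≡ toℕ j
    i+suc-d≡j = trans (+-suc (toℕ i) d) (m+[n∸m]≡n i<j)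

  InCyclic-commute : ∀ {g} → InCyclic σ g → ∀ k y → g ⟨$⟩ʳ pow k y ≡ pow k (g ⟨$⟩ʳ y)
  InCyclic-commute {g} (e , g≈σᵉ) k y = begin
    g ⟨$⟩ʳ pow k y   ≡⟨ g≈σᵉ (pow k y) ⟩
    pow e (pow k y) ≡⟨ pow-comm e k y ⟩
    pow k (pow e y) ≡⟨ cong (pow k) (g≈σᵉ y) ⟨
    pow k (g ⟨$⟩ʳ y) ∎
    where open ≡-Reasoning

  InCyclic-·σ^ : ∀ {a} t → InCyclic σ a → InCyclic σ (a ·σ^ t)
  InCyclic-·σ^ t (e , a≈σᵉ) = e + t , λ y → trans (cong (pow t) (a≈σᵉ y)) (sym (pow-+ e t y))

  ·σ^-cancelʳ : ∀ {a b} t → a ·σ^ t ≈ b ·σ^ t → a ≈ b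
  ·σ^-cancelʳ t eq y = pow-injective t (eq y)

  ·σ^-comm : ∀ a s t → a ·σ^ s ·σ^ t ≈ a ·σ^ t ·σ^ s
  ·σ^-comm a s t y = pow-comm t s (a ⟨$⟩ʳ y)

  ·σ^-+ : ∀ a s t → a ·σ^ (s + t) ≈ a ·σ^ s ·σ^ t
  ·σ^-+ a s t y = pow-+ s t (a ⟨$⟩ʳ y)

  ≈-dec : (a b : Perm) → Dec (a ≈ b)
  ≈-dec a b = all? (λ i → a ⟨$⟩ʳ i ≟ᶠ b ⟨$⟩ʳ i)

  Agree : Perm → Perm → Set
  Agree a b = ∃ λ z → a ⟨$⟩ʳ z ≡ b ⟨$⟩ʳ z

  Intersect⇒Agree : ∀ {a b} → Intersect a b → Agree a b
  Intersect⇒Agree {b = b} (y , fixed) = b ⟨$⟩ˡ y , trans fixed (sym (inverseʳ b))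

  Agree-·σ^ : ∀ {a b} t → Agree a b → Agree (a ·σ^ t) (b ·σ^ t)
  Agree-·σ^ t (z , az≡bz) = z , cong (pow t) az≡bz

  record ShortestCycle : Set where
    field
      ℓ                 : ℕ
      ⦃ ℓ-nonZero ⦄     : NonZero ℓ
      x₀                : Fin n
      x₀-returns        : pow ℓ x₀ ≡ x₀
      no-shorter-return : ∀ {c z} → c < ℓ → pow c z ≡ z → c ≡ 0

  SomePointReturnsAfter : ℕ → Set
  SomePointReturnsAfter k = ∃ λ z → pow k z ≡ z

  shortest-cycle : Fin n → ShortestCycle
  shortest-cycle x
    with least-witness {λ d → SomePointReturnsAfter (suc d)}
                       (λ d → any? (λ z → pow (suc d) z ≟ᶠ z))
                       {proj₁ (pow-returns x)} (x , proj₂ (pow-returns x))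
  ... | d , (x₀ , returns) , minimal = record
    { ℓ                 = suc d
    ; x₀                = x₀
    ; x₀-returns        = returns
    ; no-shorter-return = no-shorter
    }
    where
    no-shorter : ∀ {c z} → c < suc d → pow c z ≡ z → c ≡ 0
    no-shorter {zero}  _          _       = refl
    no-shorter {suc c} (s≤s c<d) returns′ = contradiction (_ , returns′) (minimal c<d)

module LargestStabilizer {n : ℕ} {σ : Permutation′ n} (C : Powers.ShortestCycle σ) where
  open Powers σ
  open ShortestCycle C

  pow-multiple : ∀ q → pow (q * ℓ) x₀ ≡ x₀
  pow-multiple zero    = refl
  pow-multiple (suc q) = begin
    pow (ℓ + q * ℓ) x₀     ≡⟨ pow-+ ℓ (q * ℓ) x₀ ⟩
    pow (q * ℓ) (pow ℓ x₀) ≡⟨ cong (pow (q * ℓ)) x₀-returns ⟩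
    pow (q * ℓ) x₀         ≡⟨ pow-multiple q ⟩
    x₀                     ∎
    where open ≡-Reasoning

  pow-% : ∀ e → pow (e % ℓ) x₀ ≡ pow e x₀
  pow-% e = begin
    pow (e % ℓ) x₀                   ≡⟨ cong (pow (e % ℓ)) (pow-multiple (e / ℓ)) ⟨
    pow (e % ℓ) (pow (e / ℓ * ℓ) x₀) ≡⟨ pow-comm (e % ℓ) (e / ℓ * ℓ) x₀ ⟩
    pow (e / ℓ * ℓ) (pow (e % ℓ) x₀) ≡⟨ pow-+ (e % ℓ) (e / ℓ * ℓ) x₀ ⟨
    pow (e % ℓ + e / ℓ * ℓ) x₀       ≡⟨ cong (λ k → pow k x₀) (m≡m%n+[m/n]*n e ℓ) ⟨
    pow e x₀                         ∎
    where open ≡-Reasoning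

  short-shift-trivial : ∀ {a b c} → Agree a b → c < ℓ → b ≈ a ·σ^ c → b ≈ a
  short-shift-trivial {a} {b} {c} (z , az≡bz) c<ℓ b≈aσᶜ y =
    trans (b≈aσᶜ y) (cong (λ k → pow k (a ⟨$⟩ʳ y)) c≡0)
    where
    c≡0 : c ≡ 0
    c≡0 = no-shorter-return c<ℓ (trans (sym (b≈aσᶜ z)) (sym az≡bz))

  -- The k < ℓ with σ^k x₀ = y, or the junk value 0 when y is not on the cycle of x₀.
  index : Fin n → ℕ
  index y with any? (λ (k : Fin ℓ) → pow (toℕ k) x₀ ≟ᶠ y)
  ... | yes (k , _) = toℕ k
  ... | no _        = 0

  index-spec : ∀ e {y} → pow e x₀ ≡ y → index y < ℓ × pow (index y) x₀ ≡ y
  index-spec e {y} σᵉx₀≡y with any? (λ (k : Fin ℓ) → pow (toℕ k) x₀ ≟ᶠ y)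
  ... | yes (k , σᵏx₀≡y) = toℕ<n k , σᵏx₀≡y
  ... | no none = contradiction (fromℕ< (m%n<n e ℓ) , σ^[e%ℓ]x₀≡y) none
    where
    σ^[e%ℓ]x₀≡y : pow (toℕ (fromℕ< (m%n<n e ℓ))) x₀ ≡ y
    σ^[e%ℓ]x₀≡y =
      trans (cong (λ k → pow k x₀) (toℕ-fromℕ< (m%n<n e ℓ))) (trans (pow-% e) σᵉx₀≡y)

  exponent : Perm → ℕ
  exponent a = index (a ⟨$⟩ʳ x₀)

  exponent-spec : ∀ {a} → InCyclic σ a → exponent a < ℓ × pow (exponent a) x₀ ≡ a ⟨$⟩ʳ x₀
  exponent-spec {a} (e , a≈σᵉ) = index-spec e (sym (a≈σᵉ x₀))

  exponent-≡0 : ∀ {a} → a ⟨$⟩ʳ x₀ ≡ x₀ → exponent a ≡ 0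
  exponent-≡0 ax₀≡x₀ rewrite ax₀≡x₀ =
    let k<ℓ , σᵏx₀≡x₀ = index-spec 0 refl in no-shorter-return k<ℓ σᵏx₀≡x₀

  stabilize : Perm → Perm
  stabilize a = a ·σ^ (ℓ ∸ exponent a)

  stabilize-InCyclic : ∀ {a} → InCyclic σ a → InCyclic σ (stabilize a)
  stabilize-InCyclic {a} = InCyclic-·σ^ {a} (ℓ ∸ exponent a)

  stabilize-fixes : ∀ {a} → InCyclic σ a → stabilize a ⟨$⟩ʳ x₀ ≡ x₀
  stabilize-fixes {a} a∈⟨σ⟩ = begin
    pow (ℓ ∸ k) (a ⟨$⟩ʳ x₀)     ≡⟨ cong (pow (ℓ ∸ k)) σᵏx₀≡ax₀ ⟨
    pow (ℓ ∸ k) (pow k x₀)     ≡⟨ pow-+ k (ℓ ∸ k) x₀ ⟨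
    pow (k + (ℓ ∸ k)) x₀       ≡⟨ cong (λ j → pow j x₀) (m+[n∸m]≡n (<⇒≤ k<ℓ)) ⟩
    pow ℓ x₀                   ≡⟨ x₀-returns ⟩
    x₀                         ∎
    where
    open ≡-Reasoning
    k = exponent a
    k<ℓ = proj₁ (exponent-spec {a} a∈⟨σ⟩)
    σᵏx₀≡ax₀ = proj₂ (exponent-spec {a} a∈⟨σ⟩)

  stabilize-≈⇒short-shift : ∀ {a b} → InCyclic σ b → stabilize a ≈ stabilize b →
                            exponent a ≤ exponent b → ∃ λ c → c < ℓ × b ≈ a ·σ^ c
  stabilize-≈⇒short-shift {a} {b} b∈⟨σ⟩ eq i≤j =
    j ∸ i , ≤-<-trans (m∸n≤m j i) j<ℓ ,
    ·σ^-cancelʳ {b} {a ·σ^ (j ∸ i)} (ℓ ∸ j) b≈aσᶜ·σ^[ℓ∸j]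
    where
    i = exponent a
    j = exponent b
    j<ℓ = proj₁ (exponent-spec {b} b∈⟨σ⟩)
    ℓ∸i≡[j∸i]+[ℓ∸j] : ℓ ∸ i ≡ (j ∸ i) + (ℓ ∸ j)
    ℓ∸i≡[j∸i]+[ℓ∸j] = begin
      ℓ ∸ i               ≡⟨ cong (_∸ i) (m∸n+n≡m (<⇒≤ j<ℓ)) ⟨
      (ℓ ∸ j) + j ∸ i     ≡⟨ +-∸-assoc (ℓ ∸ j) i≤j ⟩
      (ℓ ∸ j) + (j ∸ i)   ≡⟨ +-comm (ℓ ∸ j) (j ∸ i) ⟩
      (j ∸ i) + (ℓ ∸ j)   ∎
      where open ≡-Reasoning
    b≈aσᶜ·σ^[ℓ∸j] : b ·σ^ (ℓ ∸ j) ≈ a ·σ^ (j ∸ i) ·σ^ (ℓ ∸ j)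
    b≈aσᶜ·σ^[ℓ∸j] y = begin
      pow (ℓ ∸ j) (b ⟨$⟩ʳ y)             ≡⟨ eq y ⟨
      pow (ℓ ∸ i) (a ⟨$⟩ʳ y)             ≡⟨ cong (λ k → pow k (a ⟨$⟩ʳ y)) ℓ∸i≡[j∸i]+[ℓ∸j] ⟩
      pow ((j ∸ i) + (ℓ ∸ j)) (a ⟨$⟩ʳ y) ≡⟨ ·σ^-+ a (j ∸ i) (ℓ ∸ j) y ⟩
      pow (ℓ ∸ j) (pow (j ∸ i) (a ⟨$⟩ʳ y)) ∎
      where open ≡-Reasoning

  stabilize-injective : ∀ {a b} → InCyclic σ a → InCyclic σ b → Agree a b →
                        stabilize a ≈ stabilize b → a ≈ b
  stabilize-injective {a} {b} a∈⟨σ⟩ b∈⟨σ⟩ a~b eq with ≤-total (exponent a) (exponent b)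
  ... | inj₁ i≤j =
    let c , c<ℓ , b≈aσᶜ = stabilize-≈⇒short-shift {a} {b} b∈⟨σ⟩ eq i≤j
    in λ y → sym (short-shift-trivial {a} {b} a~b c<ℓ b≈aσᶜ y)
  ... | inj₂ j≤i =
    let c , c<ℓ , a≈bσᶜ = stabilize-≈⇒short-shift {b} {a} a∈⟨σ⟩ (λ y → sym (eq y)) j≤i
    in short-shift-trivial {b} {a} (proj₁ a~b , sym (proj₂ a~b)) c<ℓ a≈bσᶜ

  shift-into-stabilizer : ∀ {g} → InCyclic σ g → ∃ λ t → (g ·σ^ t) ⟨$⟩ʳ x₀ ≡ x₀
  shift-into-stabilizer {g} (e , g≈σᵉ) = t , (begin
    pow t (g ⟨$⟩ʳ x₀)   ≡⟨ cong (pow t) (g≈σᵉ x₀) ⟩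
    pow t (pow e x₀)   ≡⟨ pow-+ e t x₀ ⟨
    pow (e + t) x₀     ≡⟨ cong (λ k → pow k x₀) (m+[n∸m]≡n (m≤m*n e ℓ)) ⟩
    pow (e * ℓ) x₀     ≡⟨ pow-multiple e ⟩
    x₀                 ∎)
    where
    open ≡-Reasoning
    t = e * ℓ ∸ e

  module IntersectingFamily (F : List Perm) (F⊆⟨σ⟩ : IsSubsetOfCyclic σ F)
                            (F-intersecting : IsIntersecting F) where

    cyclic : ∀ {a} → a ∈ F → InCyclic σ a
    cyclic = All.lookup (proj₁ F⊆⟨σ⟩)

    agree : ∀ {a b} → a ∈ F → b ∈ F → Agree a b
    agree {a} {b} a∈F b∈F =
      Intersect⇒Agree {a} {b} (All.lookup (All.lookup F-intersecting a∈F) b∈F)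

    normalize : ℕ → Perm → Perm
    normalize t a = stabilize (a ·σ^ t)

    normalize-injective : ∀ t {a b} → a ∈ F → b ∈ F → normalize t a ≈ normalize t b → a ≈ b
    normalize-injective t {a} {b} a∈F b∈F eq = ·σ^-cancelʳ {a} {b} t
      (stabilize-injective {a ·σ^ t} {b ·σ^ t} (InCyclic-·σ^ {a} t (cyclic a∈F))
        (InCyclic-·σ^ {b} t (cyclic b∈F)) (Agree-·σ^ {a} {b} t (agree a∈F b∈F)) eq)

    normalized : ℕ → List Perm
    normalized t = map (normalize t) F

    normalized-⊆-stabilizer : ∀ t → IsSubsetOfStabilizer σ x₀ (normalized t)
    normalized-⊆-stabilizer t =
      ( All-map⁺ (All.tabulate λ {a} a∈F → stabilize-InCyclic {a ·σ^ t} (shifted-cyclic a∈F))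
      , AllPairs-map⁺ (AllPairs.zipWith distinct-images (proj₂ F⊆⟨σ⟩ , members-pairwise)))
      , All-map⁺ (All.tabulate λ {a} a∈F → stabilize-fixes {a ·σ^ t} (shifted-cyclic a∈F))
      where
      shifted-cyclic : ∀ {a} → a ∈ F → InCyclic σ (a ·σ^ t)
      shifted-cyclic {a} a∈F = InCyclic-·σ^ {a} t (cyclic a∈F)
      members-pairwise : AllPairs (λ a b → a ∈ F × b ∈ F) F
      members-pairwise = all-pairs (All.tabulate λ a∈F → All.tabulate λ b∈F → a∈F , b∈F)
      distinct-images : ∀ {a b} → ¬ a ≈ b × (a ∈ F × b ∈ F) → ¬ normalize t a ≈ normalize t b
      distinct-images (a≉b , a∈F , b∈F) eq = a≉b (normalize-injective t a∈F b∈F eq)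

    ekr : ∃ λ (x : Fin n) → ∃ λ (S : List Perm) → IsSubsetOfStabilizer σ x S × length F ≤ length S
    ekr = x₀ , normalized 0 , normalized-⊆-stabilizer 0 ,
          ≤-reflexive (sym (length-map (normalize 0) F))

    module Maximum
      (maximum : (x : Fin n) (S : List Perm) → IsSubsetOfStabilizer σ x S → length S ≤ length F)
      where

      -- Otherwise normalize t g could be added to normalized t, giving a larger subset of the
      -- stabilizer.
      normalized-covers : ∀ t {g} → InCyclic σ g →
                          ∃ λ f → f ∈ F × normalize t g ≈ normalize t f
      normalized-covers t {g} g∈⟨σ⟩ with Any.any? (λ f → ≈-dec (normalize t g) (normalize t f)) F
      ... | yes hit  = find hit
      ... | no  miss = contradiction too-long (n≮n (length F))
        where
        extended : IsSubsetOfStabilizer σ x₀ (normalize t g ∷ normalized t)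
        extended = let (cyc , distinct) , fixes = normalized-⊆-stabilizer t in
          ( stabilize-InCyclic {g ·σ^ t} (InCyclic-·σ^ {g} t g∈⟨σ⟩) ∷ cyc
          , All-map⁺ (¬Any⇒All¬ F miss) ∷ distinct)
          , stabilize-fixes {g ·σ^ t} (InCyclic-·σ^ {g} t g∈⟨σ⟩) ∷ fixes
        too-long : length F < length F
        too-long = subst (λ k → suc k ≤ length F) (length-map (normalize t) F)
                         (maximum x₀ _ extended)

      ShortShiftOfMember : Perm → Set
      ShortShiftOfMember g = ∃ λ f → f ∈ F × ∃ λ c → c < ℓ × f ≈ g ·σ^ c

      -- Shift g into the stabilizer by some σ^t, where its exponent is 0, and cancel σ^t afterwards.
      window : ∀ {g} → InCyclic σ g → ShortShiftOfMember g
      window {g} g∈⟨σ⟩ with shift-into-stabilizer {g} g∈⟨σ⟩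
      ... | t , gσᵗx₀≡x₀ with normalized-covers t {g} g∈⟨σ⟩
      ... | f , f∈F , eq =
        let c , c<ℓ , fσᵗ≈gσᵗσᶜ = stabilize-≈⇒short-shift {g ·σ^ t} {f ·σ^ t}
                                    (InCyclic-·σ^ {f} t (cyclic f∈F)) eq exponent-≤
        in f , f∈F , c , c<ℓ ,
           ·σ^-cancelʳ {f} {g ·σ^ c} t (λ y → trans (fσᵗ≈gσᵗσᶜ y) (·σ^-comm g t c y))
        where
        exponent-≤ : exponent (g ·σ^ t) ≤ exponent (f ·σ^ t)
        exponent-≤ = subst (_≤ exponent (f ·σ^ t)) (sym (exponent-≡0 {g ·σ^ t} gσᵗx₀≡x₀)) z≤n

      closure : ∀ {f} → f ∈ F → ∃ λ f′ → f′ ∈ F × f′ ≈ f ·σ^ ℓ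
      closure {f} f∈F = full-turn (window {f ·σ^ 1} (InCyclic-·σ^ {f} 1 (cyclic f∈F)))
        where
        full-turn : ShortShiftOfMember (f ·σ^ 1) → ∃ λ f′ → f′ ∈ F × f′ ≈ f ·σ^ ℓ
        full-turn (f′ , f′∈F , c , c<ℓ , f′≈fσσᶜ) = f′ , f′∈F , f′≈fσ^ℓ
          where
          z = proj₁ (agree f′∈F f∈F)
          returns : pow (suc c) (f ⟨$⟩ʳ z) ≡ f ⟨$⟩ʳ z
          returns = trans (·σ^-+ f 1 c z) (trans (sym (f′≈fσσᶜ z)) (proj₂ (agree f′∈F f∈F)))
          1+c≡ℓ : suc c ≡ ℓ
          1+c≡ℓ with m≤n⇒m<n∨m≡n c<ℓ
          ... | inj₁ 1+c<ℓ = contradiction (no-shorter-return 1+c<ℓ returns) λ ()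
          ... | inj₂ 1+c≡ℓ = 1+c≡ℓ
          f′≈fσ^ℓ : f′ ≈ f ·σ^ ℓ
          f′≈fσ^ℓ y = trans (f′≈fσσᶜ y)
                            (trans (sym (·σ^-+ f 1 c y)) (cong (λ k → pow k (f ⟨$⟩ʳ y)) 1+c≡ℓ))

      closure-iterate : ∀ q {g} → g ∈ F → ∃ λ h → h ∈ F × h ≈ g ·σ^ (q * ℓ)
      closure-iterate zero    g∈F = _ , g∈F , λ y → refl
      closure-iterate (suc q) {g} g∈F =
        let h  , h∈F  , h≈gσ^qℓ = closure-iterate q g∈F
            h′ , h′∈F , h′≈hσ^ℓ = closure h∈F
        in h′ , h′∈F , λ y → begin
        h′ ⟨$⟩ʳ y                        ≡⟨ h′≈hσ^ℓ y ⟩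
        pow ℓ (h ⟨$⟩ʳ y)                 ≡⟨ cong (pow ℓ) (h≈gσ^qℓ y) ⟩
        pow ℓ (pow (q * ℓ) (g ⟨$⟩ʳ y))   ≡⟨ pow-comm ℓ (q * ℓ) (g ⟨$⟩ʳ y) ⟩
        pow (q * ℓ) (pow ℓ (g ⟨$⟩ʳ y))   ≡⟨ pow-+ ℓ (q * ℓ) (g ⟨$⟩ʳ y) ⟨
        pow (ℓ + q * ℓ) (g ⟨$⟩ʳ y)       ∎
        where open ≡-Reasoning

      -- Write a ∸ b = q ℓ + r with r < ℓ: then f = h σ^r for the member h = g σ^(q ℓ) of F,
      -- forcing r = 0.
      agree-at-x₀-≤ : ∀ {f g a b} → f ∈ F → g ∈ F → f ≈ σ ^ₚ a → g ≈ σ ^ₚ b → b ≤ a →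
                      f ⟨$⟩ʳ x₀ ≡ g ⟨$⟩ʳ x₀
      agree-at-x₀-≤ {f} {g} {a} {b} f∈F g∈F f≈σᵃ g≈σᵇ b≤a = via (closure-iterate q g∈F)
        where
        open ≡-Reasoning
        q = (a ∸ b) / ℓ
        r = (a ∸ b) % ℓ
        r<ℓ : r < ℓ
        r<ℓ = m%n<n (a ∸ b) ℓ
        a≡b+qℓ+r : a ≡ b + q * ℓ + r
        a≡b+qℓ+r = begin
          a                   ≡⟨ m+[n∸m]≡n b≤a ⟨
          b + (a ∸ b)         ≡⟨ cong (b +_) (m≡m%n+[m/n]*n (a ∸ b) ℓ) ⟩
          b + (r + q * ℓ)     ≡⟨ cong (b +_) (+-comm r (q * ℓ)) ⟩
          b + (q * ℓ + r)     ≡⟨ +-assoc b (q * ℓ) r ⟨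
          b + q * ℓ + r       ∎
        via : (∃ λ h → h ∈ F × h ≈ g ·σ^ (q * ℓ)) → f ⟨$⟩ʳ x₀ ≡ g ⟨$⟩ʳ x₀
        via (h , h∈F , h≈gσ^qℓ) = begin
          f ⟨$⟩ʳ x₀                 ≡⟨ short-shift-trivial {h} {f} (agree h∈F f∈F) r<ℓ f≈hσʳ x₀ ⟩
          h ⟨$⟩ʳ x₀                 ≡⟨ h≈gσ^qℓ x₀ ⟩
          pow (q * ℓ) (g ⟨$⟩ʳ x₀)   ≡⟨ InCyclic-commute {g} (b , g≈σᵇ) (q * ℓ) x₀ ⟨
          g ⟨$⟩ʳ pow (q * ℓ) x₀     ≡⟨ cong (g ⟨$⟩ʳ_) (pow-multiple q) ⟩
          g ⟨$⟩ʳ x₀                 ∎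
          where
          f≈hσʳ : f ≈ h ·σ^ r
          f≈hσʳ y = begin
            f ⟨$⟩ʳ y                          ≡⟨ f≈σᵃ y ⟩
            pow a y                           ≡⟨ cong (λ k → pow k y) a≡b+qℓ+r ⟩
            pow (b + q * ℓ + r) y             ≡⟨ pow-+ (b + q * ℓ) r y ⟩
            pow r (pow (b + q * ℓ) y)         ≡⟨ cong (pow r) (pow-+ b (q * ℓ) y) ⟩
            pow r (pow (q * ℓ) (pow b y))     ≡⟨ cong (λ x → pow r (pow (q * ℓ) x)) (g≈σᵇ y) ⟨
            pow r (pow (q * ℓ) (g ⟨$⟩ʳ y))    ≡⟨ cong (pow r) (h≈gσ^qℓ y) ⟨
            pow r (h ⟨$⟩ʳ y)                  ∎

      agree-at-x₀ : ∀ {f g} → f ∈ F → g ∈ F → f ⟨$⟩ʳ x₀ ≡ g ⟨$⟩ʳ x₀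
      agree-at-x₀ f∈F g∈F =
        let a , f≈σᵃ = cyclic f∈F
            b , g≈σᵇ = cyclic g∈F
        in [ agree-at-x₀-≤ f∈F g∈F f≈σᵃ g≈σᵇ
           , (λ a≤b → sym (agree-at-x₀-≤ g∈F f∈F g≈σᵇ f≈σᵃ a≤b)) ]′ (≤-total b a)

      member : ∃ λ f₀ → f₀ ∈ F
      member = nonempty F (maximum x₀ (id ∷ []) id-stabilizes)
        where
        id-stabilizes : IsSubsetOfStabilizer σ x₀ (id ∷ [])
        id-stabilizes = (((0 , λ _ → refl) ∷ []) , ([] ∷ [])) , (refl ∷ [])
        nonempty : ∀ xs → 1 ≤ length xs → ∃ λ x → x ∈ xs
        nonempty (x ∷ _) _ = x , here refl

      coset : IsCoset σ F
      coset = x₀ , f₀ ⟨$⟩ʳ x₀ , All.tabulate (λ f∈F → agree-at-x₀ f∈F f₀∈F) , covered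
        where
        f₀ = proj₁ member
        f₀∈F = proj₂ member
        covered : (π : Perm) → InCyclic σ π → π ⟨$⟩ʳ x₀ ≡ f₀ ⟨$⟩ʳ x₀ → Any (π ≈_) F
        covered π π∈⟨σ⟩ πx₀≡f₀x₀ with window {π} π∈⟨σ⟩
        ... | f , f∈F , c , c<ℓ , f≈πσᶜ = Any.map (λ f≡ → subst (π ≈_) f≡ π≈f) f∈F
          where
          π~f : Agree π f
          π~f = x₀ , trans πx₀≡f₀x₀ (agree-at-x₀ f₀∈F f∈F)
          π≈f : π ≈ f
          π≈f y = sym (short-shift-trivial {π} {f} π~f c<ℓ f≈πσᶜ y)

theorem5p5 : (m : ℕ) (σ : Permutation′ (suc m)) → HasStrictEKR σ
theorem5p5 m σ =
  (λ F F⊆⟨σ⟩ F-intersecting → ekr F F⊆⟨σ⟩ F-intersecting) ,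
  (λ F F⊆⟨σ⟩ F-intersecting maximum → Maximum.coset F F⊆⟨σ⟩ F-intersecting maximum)
  where
  open LargestStabilizer (Powers.shortest-cycle σ 0F)
  open IntersectingFamily
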